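{- Let $t$ be an indeterminate (equivalently, an arbitrary rational or integer parameter), and define the polynomials \[ \begin{aligned} x_1 &= 3t^4 + 40t^3 - 274t^2 + 48t + 1383, & x_2 &= t^4 - 88t^3 - 214t^2 + 736t - 675,\\ x_3 &= 7t^4 + 14t^3 - 152t^2 + 962t + 609, & x_4 &= 4t^4 - 70t^3 + 46t^2 + 254t - 1914,\\ y_1 &= 4t^4 - 6t^3 - 274t^2 - 642t + 1158, & y_2 &= 3t^4 - 92t^3 - 62t^2 + 676t + 1155,\\ y_3 &= 7t^4 + 12t^3 - 14t^2 - 1124t - 81, & y_4 &= t^4 + 66t^3 + 184t^2 + 238t - 1929. \end{aligned} \] Then $\sum_{i=1}^4 x_i^r=\sum_{i=1}^4 y_i^r$ holds identically in $t$ for $r=2,4,6$. Consequently, setting $x_{i+4}=-x_i$ and $y_{i+4}=-y_i$ for $i=1,\dots,4$, one has $\sum_{i=1}^8 x_i^r=\sum_{i=1}^8 y_i^r$ identically in $t$ for $r=1,2,\dots,7$, i.e. these give a parametric ideal solution of degree 4 of the Tarry–Escott problem of degree 7.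
   Context: The Tarry–Escott problem of degree $k$ asks for two distinct multisets of integers $\{x_1,\dots,x_s\}$ and $\{y_1,\dots,y_s\}$ with $\sum_{i=1}^s x_i^r=\sum_{i=1}^s y_i^r$ for $r=1,\dots,k$; a solution with $s=k+1$ is called ideal. -}

module Defs where

open import Data.Integer using (ℤ; +_; -_; _+_; _*_; _-_)
open import Data.Nat using (ℕ)
open import Data.Fin using (Fin)
open import Data.List using (List; []; _∷_; map; foldr)
import Data.Integer as ℤ

_^_ : ℤ → ℕ → ℤ
_^_ = ℤ._^_

xs4 : ℤ → List ℤ
xs4 t =
    (+ 3 * t ^ 4 + + 40 * t ^ 3 - + 274 * t ^ 2 + + 48 * t + + 1383)
  ∷ (t ^ 4 - + 88 * t ^ 3 - + 214 * t ^ 2 + + 736 * t - + 675)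
  ∷ (+ 7 * t ^ 4 + + 14 * t ^ 3 - + 152 * t ^ 2 + + 962 * t + + 609)
  ∷ (+ 4 * t ^ 4 - + 70 * t ^ 3 + + 46 * t ^ 2 + + 254 * t - + 1914)
  ∷ []

ys4 : ℤ → List ℤ
ys4 t =
    (+ 4 * t ^ 4 - + 6 * t ^ 3 - + 274 * t ^ 2 - + 642 * t + + 1158)
  ∷ (+ 3 * t ^ 4 - + 92 * t ^ 3 - + 62 * t ^ 2 + + 676 * t + + 1155)
  ∷ (+ 7 * t ^ 4 + + 12 * t ^ 3 - + 14 * t ^ 2 - + 1124 * t - + 81)
  ∷ (t ^ 4 + + 66 * t ^ 3 + + 184 * t ^ 2 + + 238 * t - + 1929)
  ∷ []

xs8 : ℤ → List ℤ
xs8 t = xs4 t Data.List.++ map -_ (xs4 t)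

ys8 : ℤ → List ℤ
ys8 t = ys4 t Data.List.++ map -_ (ys4 t)

powSum : ℕ → List ℤ → ℤ
powSum r zs = foldr _+_ (+ 0) (map (λ z → z ^ r) zs)

-- Each x_i, y_i is an integer polynomial in t, so the even power-sum identities are
-- identities between coefficient lists, which are checked by computation.  For the
-- eight-term lists z, -z the odd power sums vanish and the even ones are twice the
-- four-term sums, so degrees 1..7 follow from degrees 2, 4, 6.
module Submission where

open import Defs
open import Data.Integer using (ℤ; +_; -_; _+_; _*_; _-_; 0ℤ; 1ℤ)
open import Data.Integer.Properties using (+-identityˡ; +-identityʳ; *-zeroʳ; +-assoc; +-inverseʳ; neg-distrib-+; neg-distribˡ-*; ^-*-assoc)
open import Data.Integer.Tactic.RingSolver using (solve-∀)
open import Data.Nat using (ℕ; zero; suc; _≤_; s≤s)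
import Data.Nat as ℕ
open import Data.List using (List; []; _∷_; map; foldr; _++_)
open import Data.Product using (_×_; _,_; proj₁; proj₂)
open import Relation.Binary.PropositionalEquality using (_≡_; refl; sym; trans; cong; cong₂; module ≡-Reasoning)

-- Integer polynomials as coefficient lists, constant term first.
Poly : Set
Poly = List ℤ

eval : Poly → ℤ → ℤ
eval []      t = 0ℤ
eval (a ∷ p) t = a + t * eval p t

infixl 6 _+ᴾ_
infixl 7 _*ᴾ_
infixr 8 _^ᴾ_

_+ᴾ_ : Poly → Poly → Poly
[]      +ᴾ q       = q
(a ∷ p) +ᴾ []      = a ∷ p
(a ∷ p) +ᴾ (b ∷ q) = (a + b) ∷ (p +ᴾ q)

_*ᴾ_ : Poly → Poly → Poly
[]      *ᴾ q = []
(a ∷ p) *ᴾ q = map (a *_) q +ᴾ (0ℤ ∷ p *ᴾ q)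

_^ᴾ_ : Poly → ℕ → Poly
p ^ᴾ zero  = 1ℤ ∷ []
p ^ᴾ suc n = p *ᴾ p ^ᴾ n

powSumᴾ : ℕ → List Poly → Poly
powSumᴾ r ps = foldr _+ᴾ_ [] (map (_^ᴾ r) ps)

eval-+ᴾ : ∀ p q t → eval (p +ᴾ q) t ≡ eval p t + eval q t
eval-+ᴾ []      q       t = sym (+-identityˡ (eval q t))
eval-+ᴾ (a ∷ p) []      t = sym (+-identityʳ (eval (a ∷ p) t))
eval-+ᴾ (a ∷ p) (b ∷ q) t =
  trans (cong (λ s → a + b + t * s) (eval-+ᴾ p q t)) (interchange a b t (eval p t) (eval q t))
  where
  interchange : ∀ a b t x y → a + b + t * (x + y) ≡ a + t * x + (b + t * y)
  interchange = solve-∀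

eval-scale : ∀ c q t → eval (map (c *_) q) t ≡ c * eval q t
eval-scale c []      t = sym (*-zeroʳ c)
eval-scale c (b ∷ q) t =
  trans (cong (λ s → c * b + t * s) (eval-scale c q t)) (factor c b t (eval q t))
  where
  factor : ∀ c b t y → c * b + t * (c * y) ≡ c * (b + t * y)
  factor = solve-∀

eval-*ᴾ : ∀ p q t → eval (p *ᴾ q) t ≡ eval p t * eval q t
eval-*ᴾ []      q t = refl
eval-*ᴾ (a ∷ p) q t = begin
  eval (map (a *_) q +ᴾ (0ℤ ∷ p *ᴾ q)) t   ≡⟨ eval-+ᴾ (map (a *_) q) (0ℤ ∷ p *ᴾ q) t ⟩
  eval (map (a *_) q) t + (0ℤ + t * eval (p *ᴾ q) t)
    ≡⟨ cong₂ (λ u v → u + (0ℤ + t * v)) (eval-scale a q t) (eval-*ᴾ p q t) ⟩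
  a * eval q t + (0ℤ + t * (eval p t * eval q t))
    ≡⟨ distrib a (eval q t) t (eval p t) ⟩
  (a + t * eval p t) * eval q t            ∎
  where
  open ≡-Reasoning
  distrib : ∀ a y t x → a * y + (0ℤ + t * (x * y)) ≡ (a + t * x) * y
  distrib = solve-∀

eval-^ᴾ : ∀ p n t → eval (p ^ᴾ n) t ≡ eval p t ^ n
eval-^ᴾ p zero    t = trans (cong (_+_ 1ℤ) (*-zeroʳ t)) (+-identityʳ 1ℤ)
eval-^ᴾ p (suc n) t = trans (eval-*ᴾ p (p ^ᴾ n) t) (cong (eval p t *_) (eval-^ᴾ p n t))

eval-powSumᴾ : ∀ r ps t → eval (powSumᴾ r ps) t ≡ powSum r (map (λ p → eval p t) ps)
eval-powSumᴾ r []       t = refl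
eval-powSumᴾ r (p ∷ ps) t =
  trans (eval-+ᴾ (p ^ᴾ r) (powSumᴾ r ps) t) (cong₂ _+_ (eval-^ᴾ p r t) (eval-powSumᴾ r ps t))

powSum-eval-cong : ∀ r ps qs → powSumᴾ r ps ≡ powSumᴾ r qs →
                   ∀ t → powSum r (map (λ p → eval p t) ps) ≡ powSum r (map (λ q → eval q t) qs)
powSum-eval-cong r ps qs eq t = begin
  powSum r (map (λ p → eval p t) ps) ≡⟨ sym (eval-powSumᴾ r ps t) ⟩
  eval (powSumᴾ r ps) t              ≡⟨ cong (λ s → eval s t) eq ⟩
  eval (powSumᴾ r qs) t              ≡⟨ eval-powSumᴾ r qs t ⟩
  powSum r (map (λ q → eval q t) qs) ∎
  where open ≡-Reasoning

powSum-++ : ∀ r xs ys → powSum r (xs ++ ys) ≡ powSum r xs + powSum r ys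
powSum-++ r []       ys = sym (+-identityˡ (powSum r ys))
powSum-++ r (x ∷ xs) ys =
  trans (cong (_+_ (x ^ r)) (powSum-++ r xs ys)) (sym (+-assoc (x ^ r) (powSum r xs) (powSum r ys)))

neg-^-even : ∀ k z → (- z) ^ (2 ℕ.* k) ≡ z ^ (2 ℕ.* k)
neg-^-even k z = begin
  (- z) ^ (2 ℕ.* k)   ≡⟨ sym (^-*-assoc (- z) 2 k) ⟩
  ((- z) ^ 2) ^ k     ≡⟨ cong (_^ k) (neg-square z) ⟩
  (z ^ 2) ^ k         ≡⟨ ^-*-assoc z 2 k ⟩
  z ^ (2 ℕ.* k)       ∎
  where
  open ≡-Reasoning
  -- (- z) ^ 2 unfolded: the ring solver does not see through ℤ's _^_.
  neg-square : ∀ z → (- z) * ((- z) * 1ℤ) ≡ z * (z * 1ℤ)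
  neg-square = solve-∀

neg-^-odd : ∀ k z → (- z) ^ suc (2 ℕ.* k) ≡ - z ^ suc (2 ℕ.* k)
neg-^-odd k z = trans (cong ((- z) *_) (neg-^-even k z)) (sym (neg-distribˡ-* z (z ^ (2 ℕ.* k))))

powSum-neg-even : ∀ r → (∀ z → (- z) ^ r ≡ z ^ r) → ∀ zs → powSum r (map -_ zs) ≡ powSum r zs
powSum-neg-even r neg-^ []       = refl
powSum-neg-even r neg-^ (z ∷ zs) = cong₂ _+_ (neg-^ z) (powSum-neg-even r neg-^ zs)

powSum-neg-odd : ∀ r → (∀ z → (- z) ^ r ≡ - z ^ r) → ∀ zs → powSum r (map -_ zs) ≡ - powSum r zs
powSum-neg-odd r neg-^ []       = refl
powSum-neg-odd r neg-^ (z ∷ zs) =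
  trans (cong₂ _+_ (neg-^ z) (powSum-neg-odd r neg-^ zs)) (sym (neg-distrib-+ (z ^ r) (powSum r zs)))

antipodal : List ℤ → List ℤ
antipodal zs = zs ++ map -_ zs

powSum-antipodal-odd : ∀ r → (∀ z → (- z) ^ r ≡ - z ^ r) → ∀ zs → powSum r (antipodal zs) ≡ 0ℤ
powSum-antipodal-odd r neg-^ zs = begin
  powSum r (antipodal zs)             ≡⟨ powSum-++ r zs (map -_ zs) ⟩
  powSum r zs + powSum r (map -_ zs)  ≡⟨ cong (_+_ (powSum r zs)) (powSum-neg-odd r neg-^ zs) ⟩
  powSum r zs - powSum r zs           ≡⟨ +-inverseʳ (powSum r zs) ⟩
  0ℤ                                  ∎
  where open ≡-Reasoning

powSum-antipodal-even : ∀ r → (∀ z → (- z) ^ r ≡ z ^ r) → ∀ zs →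
                        powSum r (antipodal zs) ≡ powSum r zs + powSum r zs
powSum-antipodal-even r neg-^ zs =
  trans (powSum-++ r zs (map -_ zs)) (cong (_+_ (powSum r zs)) (powSum-neg-even r neg-^ zs))

powSum-antipodal-even-cong : ∀ r → (∀ z → (- z) ^ r ≡ z ^ r) → ∀ xs ys → powSum r xs ≡ powSum r ys →
                             powSum r (antipodal xs) ≡ powSum r (antipodal ys)
powSum-antipodal-even-cong r neg-^ xs ys eq = begin
  powSum r (antipodal xs)    ≡⟨ powSum-antipodal-even r neg-^ xs ⟩
  powSum r xs + powSum r xs  ≡⟨ cong₂ _+_ eq eq ⟩
  powSum r ys + powSum r ys  ≡⟨ sym (powSum-antipodal-even r neg-^ ys) ⟩
  powSum r (antipodal ys)    ∎
  where open ≡-Reasoning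

powSum-antipodal-odd-cong : ∀ r → (∀ z → (- z) ^ r ≡ - z ^ r) → ∀ xs ys →
                            powSum r (antipodal xs) ≡ powSum r (antipodal ys)
powSum-antipodal-odd-cong r neg-^ xs ys =
  trans (powSum-antipodal-odd r neg-^ xs) (sym (powSum-antipodal-odd r neg-^ ys))

X Y : List Poly
X = (+ 1383 ∷ + 48 ∷ - + 274 ∷ + 40 ∷ + 3 ∷ [])
  ∷ (- + 675 ∷ + 736 ∷ - + 214 ∷ - + 88 ∷ + 1 ∷ [])
  ∷ (+ 609 ∷ + 962 ∷ - + 152 ∷ + 14 ∷ + 7 ∷ [])
  ∷ (- + 1914 ∷ + 254 ∷ + 46 ∷ - + 70 ∷ + 4 ∷ [])
  ∷ []
Y = (+ 1158 ∷ - + 642 ∷ - + 274 ∷ - + 6 ∷ + 4 ∷ [])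
  ∷ (+ 1155 ∷ + 676 ∷ - + 62 ∷ - + 92 ∷ + 3 ∷ [])
  ∷ (- + 81 ∷ - + 1124 ∷ - + 14 ∷ + 12 ∷ + 7 ∷ [])
  ∷ (- + 1929 ∷ + 238 ∷ + 184 ∷ + 66 ∷ + 1 ∷ [])
  ∷ []

-- Powers and Horner forms are unfolded for the ring solver; the two sides are
-- definitionally the entries of xs4 t and their evaluations.
xs4-coefficients : ∀ t → xs4 t ≡ map (λ p → eval p t) X
xs4-coefficients t = cong₂ _∷_ (x₁ t) (cong₂ _∷_ (x₂ t) (cong₂ _∷_ (x₃ t) (cong₂ _∷_ (x₄ t) refl)))
  where
  x₁ : ∀ t → let t² = t * (t * 1ℤ); t³ = t * t²; t⁴ = t * t³ in
       + 3 * t⁴ + + 40 * t³ - + 274 * t² + + 48 * t + + 1383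
       ≡ + 1383 + t * (+ 48 + t * (- + 274 + t * (+ 40 + t * (+ 3 + t * 0ℤ))))
  x₁ = solve-∀
  x₂ : ∀ t → let t² = t * (t * 1ℤ); t³ = t * t²; t⁴ = t * t³ in
       t⁴ - + 88 * t³ - + 214 * t² + + 736 * t - + 675
       ≡ - + 675 + t * (+ 736 + t * (- + 214 + t * (- + 88 + t * (+ 1 + t * 0ℤ))))
  x₂ = solve-∀
  x₃ : ∀ t → let t² = t * (t * 1ℤ); t³ = t * t²; t⁴ = t * t³ in
       + 7 * t⁴ + + 14 * t³ - + 152 * t² + + 962 * t + + 609
       ≡ + 609 + t * (+ 962 + t * (- + 152 + t * (+ 14 + t * (+ 7 + t * 0ℤ))))
  x₃ = solve-∀
  x₄ : ∀ t → let t² = t * (t * 1ℤ); t³ = t * t²; t⁴ = t * t³ in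
       + 4 * t⁴ - + 70 * t³ + + 46 * t² + + 254 * t - + 1914
       ≡ - + 1914 + t * (+ 254 + t * (+ 46 + t * (- + 70 + t * (+ 4 + t * 0ℤ))))
  x₄ = solve-∀

ys4-coefficients : ∀ t → ys4 t ≡ map (λ p → eval p t) Y
ys4-coefficients t = cong₂ _∷_ (y₁ t) (cong₂ _∷_ (y₂ t) (cong₂ _∷_ (y₃ t) (cong₂ _∷_ (y₄ t) refl)))
  where
  y₁ : ∀ t → let t² = t * (t * 1ℤ); t³ = t * t²; t⁴ = t * t³ in
       + 4 * t⁴ - + 6 * t³ - + 274 * t² - + 642 * t + + 1158
       ≡ + 1158 + t * (- + 642 + t * (- + 274 + t * (- + 6 + t * (+ 4 + t * 0ℤ))))
  y₁ = solve-∀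
  y₂ : ∀ t → let t² = t * (t * 1ℤ); t³ = t * t²; t⁴ = t * t³ in
       + 3 * t⁴ - + 92 * t³ - + 62 * t² + + 676 * t + + 1155
       ≡ + 1155 + t * (+ 676 + t * (- + 62 + t * (- + 92 + t * (+ 3 + t * 0ℤ))))
  y₂ = solve-∀
  y₃ : ∀ t → let t² = t * (t * 1ℤ); t³ = t * t²; t⁴ = t * t³ in
       + 7 * t⁴ + + 12 * t³ - + 14 * t² - + 1124 * t - + 81
       ≡ - + 81 + t * (- + 1124 + t * (- + 14 + t * (+ 12 + t * (+ 7 + t * 0ℤ))))
  y₃ = solve-∀
  y₄ : ∀ t → let t² = t * (t * 1ℤ); t³ = t * t²; t⁴ = t * t³ in
       t⁴ + + 66 * t³ + + 184 * t² + + 238 * t - + 1929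
       ≡ - + 1929 + t * (+ 238 + t * (+ 184 + t * (+ 66 + t * (+ 1 + t * 0ℤ))))
  y₄ = solve-∀

X-Y-even-powSums : powSumᴾ 2 X ≡ powSumᴾ 2 Y × powSumᴾ 4 X ≡ powSumᴾ 4 Y × powSumᴾ 6 X ≡ powSumᴾ 6 Y
X-Y-even-powSums = refl , refl , refl

powSum-xs4-ys4 : ∀ r → powSumᴾ r X ≡ powSumᴾ r Y → ∀ t → powSum r (xs4 t) ≡ powSum r (ys4 t)
powSum-xs4-ys4 r eq t = begin
  powSum r (xs4 t)                   ≡⟨ cong (powSum r) (xs4-coefficients t) ⟩
  powSum r (map (λ p → eval p t) X)  ≡⟨ powSum-eval-cong r X Y eq t ⟩
  powSum r (map (λ q → eval q t) Y)  ≡⟨ cong (powSum r) (sym (ys4-coefficients t)) ⟩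
  powSum r (ys4 t)                   ∎
  where open ≡-Reasoning

mainTheorem2 :
    ((t : ℤ) → (powSum 2 (xs4 t) ≡ powSum 2 (ys4 t))
             × (powSum 4 (xs4 t) ≡ powSum 4 (ys4 t))
             × (powSum 6 (xs4 t) ≡ powSum 6 (ys4 t)))
    × ((t : ℤ) (r : ℕ) → 1 ≤ r → r ≤ 7 → powSum r (xs8 t) ≡ powSum r (ys8 t))
mainTheorem2 = evenPowerSums , antipodalPowerSums
  where
  evenPowerSums : ∀ t → powSum 2 (xs4 t) ≡ powSum 2 (ys4 t)
                      × powSum 4 (xs4 t) ≡ powSum 4 (ys4 t)
                      × powSum 6 (xs4 t) ≡ powSum 6 (ys4 t)
  evenPowerSums t = let e₂ , e₄ , e₆ = X-Y-even-powSums in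
    powSum-xs4-ys4 2 e₂ t , powSum-xs4-ys4 4 e₄ t , powSum-xs4-ys4 6 e₆ t

  antipodalPowerSums : (t : ℤ) (r : ℕ) → 1 ≤ r → r ≤ 7 → powSum r (xs8 t) ≡ powSum r (ys8 t)
  antipodalPowerSums t 1 _ _ = powSum-antipodal-odd-cong 1 (neg-^-odd 0) (xs4 t) (ys4 t)
  antipodalPowerSums t 2 _ _ = powSum-antipodal-even-cong 2 (neg-^-even 1) (xs4 t) (ys4 t) (proj₁ (evenPowerSums t))
  antipodalPowerSums t 3 _ _ = powSum-antipodal-odd-cong 3 (neg-^-odd 1) (xs4 t) (ys4 t)
  antipodalPowerSums t 4 _ _ = powSum-antipodal-even-cong 4 (neg-^-even 2) (xs4 t) (ys4 t) (proj₁ (proj₂ (evenPowerSums t)))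
  antipodalPowerSums t 5 _ _ = powSum-antipodal-odd-cong 5 (neg-^-odd 2) (xs4 t) (ys4 t)
  antipodalPowerSums t 6 _ _ = powSum-antipodal-even-cong 6 (neg-^-even 3) (xs4 t) (ys4 t) (proj₂ (proj₂ (evenPowerSums t)))
  antipodalPowerSums t 7 _ _ = powSum-antipodal-odd-cong 7 (neg-^-odd 3) (xs4 t) (ys4 t)
  antipodalPowerSums t (suc (suc (suc (suc (suc (suc (suc (suc _)))))))) _ (s≤s (s≤s (s≤s (s≤s (s≤s (s≤s (s≤s ())))))))
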